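{- Let $G$ be a finite simple graph with maximum degree $\Delta$. Then $\mathrm{lcc}(G)=\Delta$ if and only if there exists a vertex $x$ of $G$ of degree $\Delta$ whose neighbourhood $N(x)$ is an independent set; equivalently, $\alpha_l(G)=\Delta$.
   Context: A clique covering of a graph $G$ is a family $\mathcal{C}$ of cliques of $G$ such that every edge of $G$ is contained in at least one clique of $\mathcal{C}$; it is a $k$-clique covering if every vertex belongs to at most $k$ cliques of $\mathcal{C}$. $\mathrm{lcc}(G)$ is the smallest $k$ such that $G$ admits a $k$-clique covering. $\alpha_l(G)$ denotes the maximum $t$ such that the star $K_{1,t}$ is an induced subgraph of $G$ (i.e. the maximum size of an independent set contained in the neighbourhood of a single vertex). -}

module Defs where

open import Data.Nat using (ℕ; _≤_)
open import Data.Bool using (Bool; true; false; if_then_else_)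
import Data.Bool
import Data.Fin.Subset
import Data.List.Relation.Unary.All
open import Data.Fin using (Fin)
open import Data.Fin.Subset using (Subset; _∈_; _⊆_; ∣_∣)
open import Data.Fin.Subset.Properties using (_∈?_)
open import Data.Vec using (tabulate)
open import Data.List using (List; length; filter)
open import Data.List.Relation.Unary.Any using (Any)
open import Data.Product using (Σ; ∃; _×_)
open import Relation.Binary.PropositionalEquality using (_≡_; _≢_)

record Graph (n : ℕ) : Set where
  field
    adj    : Fin n → Fin n → Bool
    sym    : ∀ u v → adj u v ≡ adj v u
    irrefl : ∀ u → adj u u ≡ false
open Graph public

module _ {n : ℕ} (G : Graph n) where

  N : Fin n → Subset n
  N x = tabulate λ y → Data.Bool.if adj G x y then Data.Fin.Subset.inside else Data.Fin.Subset.outside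

  deg : Fin n → ℕ
  deg x = ∣ N x ∣

  MaxDegree : ℕ → Set
  MaxDegree Δ = (∃ λ x → deg x ≡ Δ) × (∀ x → deg x ≤ Δ)

  Independent : Subset n → Set
  Independent S = ∀ u v → u ∈ S → v ∈ S → adj G u v ≡ false

  IsClique : Subset n → Set
  IsClique C = ∀ u v → u ∈ C → v ∈ C → u ≢ v → adj G u v ≡ true

  multiplicity : List (Subset n) → Fin n → ℕ
  multiplicity 𝒞 v = length (filter (v ∈?_) 𝒞)

  IsKCliqueCovering : ℕ → List (Subset n) → Set
  IsKCliqueCovering k 𝒞 =
    Data.List.Relation.Unary.All.All IsClique 𝒞
    × (∀ u v → adj G u v ≡ true → Any (λ C → u ∈ C × v ∈ C) 𝒞)
    × (∀ v → multiplicity 𝒞 v ≤ k)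

  HasKCliqueCovering : ℕ → Set
  HasKCliqueCovering k = ∃ λ 𝒞 → IsKCliqueCovering k 𝒞

  LccIs : ℕ → Set
  LccIs k = HasKCliqueCovering k × (∀ k′ → HasKCliqueCovering k′ → k ≤ k′)

  -- K_{1,t} induced at x: an independent set of size t inside N(x)
  HasInducedStar : ℕ → Set
  HasInducedStar t = ∃ λ x → ∃ λ S → S ⊆ N x × Independent S × ∣ S ∣ ≡ t

  AlphaLIs : ℕ → Set
  AlphaLIs t = HasInducedStar t × (∀ t′ → HasInducedStar t′ → t′ ≤ t)

-- If some vertex x of maximum degree Δ has an independent neighbourhood, every clique through x
-- contains at most one neighbour of x, so any clique covering uses at least Δ cliques at x, while
-- the edges themselves form a Δ-clique covering.  Otherwise every vertex of degree Δ lies on a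
-- triangle; choose triangles greedily, one at each such vertex not yet covered.  At a vertex v on
-- some chosen triangle, these triangles contain more neighbours of v than there are of them, and a
-- vertex on none has degree below Δ; so adding the remaining edges as single cliques gives a
-- (Δ - 1)-clique covering.  Finally an induced star K_{1,Δ} centred at x must use all of N(x),
-- so α_l(G) = Δ says the same thing.

module Submission where

open import Defs
open import Data.Nat using (ℕ; zero; suc; pred; _+_; _≤_; _<_; z≤n; s≤s; _≟_)
open import Data.Nat.Properties
  using (≤-trans; ≤-reflexive; ≤-antisym; ≤∧≢⇒<; <-irrefl; ≤-pred; ≤⇒≯; <⇒≤pred;
         +-suc; +-mono-≤; +-monoʳ-≤; +-identityʳ; module ≤-Reasoning)
open import Data.Bool using (true; false; not; _∧_; if_then_else_)
import Data.Bool as Bool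
open import Data.Bool.Properties using (¬-not)
open import Data.Empty using (⊥-elim)
open import Data.Fin using (Fin; zero; suc)
import Data.Fin as Fin
open import Data.Fin.Properties using (any?)
open import Data.Fin.Subset
  using (Subset; inside; outside; _∈_; _∉_; _⊆_; ∣_∣; ⁅_⁆; _∪_; _∩_; _─_; _-_; ⋃)
  renaming (⊥ to ∅)
open import Data.Fin.Subset.Properties
  using (_∈?_; nonempty?; x∈p∧x∉q⇒x∈p─q; ∉⊥; ∣⊥∣≡0; x∈⁅x⁆; x∈⁅y⁆⇒x≡y; ∣⁅x⁆∣≡1; x∉⁅y⁆⇒x≢y; drop-there;
         p⊆q⇒∣p∣≤∣q∣; p⊂q⇒∣p∣<∣q∣; ∣p∣≤∣x∷p∣; x∈p∩q⁺; x∈p∩q⁻; ∣p∩q∣≤∣q∣; x∈p∪q⁺; x∈p∪q⁻;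
         q⊆p∪q; ∣p∣≤∣p∪q∣; p─q⊆p; x∈p∧x≢y⇒x∈p-y; x∈p⇒∣p-x∣<∣p∣)
open import Data.List using (List; []; _∷_; _++_; length; filter; map; allFin)
open import Data.List.Properties using (filter-++; length-++; length-map)
open import Data.List.Relation.Unary.All as All using (All; []; _∷_)
import Data.List.Relation.Unary.All.Properties as AllP
open import Data.List.Relation.Unary.Any as Any using (Any; here; there)
import Data.List.Relation.Unary.Any.Properties as AnyP
open import Data.List.Membership.Propositional.Properties using (∈-allFin; ∈-filter⁺)
open import Data.Product using (∃; ∃₂; _×_; _,_; proj₁; proj₂; swap)
open import Data.Sum using (_⊎_; inj₁; inj₂)
open import Data.Vec using (_∷_; []; tail; lookup; here; there)
open import Data.Vec.Properties using (lookup∘tabulate; []=⇒lookup; lookup⇒[]=)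
open import Function using (_∘_)
open import Function.Bundles using (_⇔_; mk⇔)
open import Relation.Nullary using (¬_; Dec; yes; no; does; contradiction)
open import Relation.Nullary.Decidable using (_×-dec_; does-⇔; dec-false)
open import Relation.Binary.PropositionalEquality as ≡ using (_≡_; _≢_; refl; cong; cong₂; subst)

private
  variable
    n : ℕ

∣p∣≡∣p∩q∣+∣p─q∣ : (p q : Subset n) → ∣ p ∣ ≡ ∣ p ∩ q ∣ + ∣ p ─ q ∣
∣p∣≡∣p∩q∣+∣p─q∣ [] [] = refl
∣p∣≡∣p∩q∣+∣p─q∣ (outside ∷ p) (outside ∷ q) = ∣p∣≡∣p∩q∣+∣p─q∣ p q
∣p∣≡∣p∩q∣+∣p─q∣ (outside ∷ p) (inside ∷ q) = ∣p∣≡∣p∩q∣+∣p─q∣ p q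
∣p∣≡∣p∩q∣+∣p─q∣ (inside ∷ p) (inside ∷ q) = cong suc (∣p∣≡∣p∩q∣+∣p─q∣ p q)
∣p∣≡∣p∩q∣+∣p─q∣ (inside ∷ p) (outside ∷ q) =
  ≡.trans (cong suc (∣p∣≡∣p∩q∣+∣p─q∣ p q)) (≡.sym (+-suc ∣ p ∩ q ∣ ∣ p ─ q ∣))

x∈p─q⇒x∉q : ∀ {x : Fin n} (p q : Subset n) → x ∈ p ─ q → x ∉ q
x∈p─q⇒x∉q (_ ∷ p) (inside ∷ q) () here
x∈p─q⇒x∉q (_ ∷ p) (_ ∷ q) (there x∈p─q) (there x∈q) = x∈p─q⇒x∉q p q x∈p─q x∈q

p-x⊆q⇒∣p∣≤1+∣q∣ : ∀ {x} {p q : Subset n} → p - x ⊆ q → ∣ p ∣ ≤ suc ∣ q ∣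
p-x⊆q⇒∣p∣≤1+∣q∣ {x = x} {p} {q} p-x⊆q = begin
  ∣ p ∣                   ≡⟨ ∣p∣≡∣p∩q∣+∣p─q∣ p ⁅ x ⁆ ⟩
  ∣ p ∩ ⁅ x ⁆ ∣ + ∣ p - x ∣ ≤⟨ +-mono-≤ (≤-trans (∣p∩q∣≤∣q∣ p ⁅ x ⁆) (≤-reflexive (∣⁅x⁆∣≡1 x))) (p⊆q⇒∣p∣≤∣q∣ p-x⊆q) ⟩
  suc ∣ q ∣               ∎
  where open ≤-Reasoning

distinct³⇒3≤∣p∣ : ∀ {x y z} {p : Subset n} → x ∈ p → y ∈ p → z ∈ p → x ≢ y → x ≢ z → y ≢ z → 3 ≤ ∣ p ∣
distinct³⇒3≤∣p∣ x∈p y∈p z∈p x≢y x≢z y≢z = ≤-trans (s≤s 2≤∣p-x∣) (x∈p⇒∣p-x∣<∣p∣ x∈p)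
  where
  y∈p-x = x∈p∧x≢y⇒x∈p-y y∈p (x≢y ∘ ≡.sym)
  z∈p-x-y = x∈p∧x≢y⇒x∈p-y (x∈p∧x≢y⇒x∈p-y z∈p (x≢z ∘ ≡.sym)) (y≢z ∘ ≡.sym)
  1≤∣p-x-y∣ = ≤-trans (s≤s z≤n) (x∈p⇒∣p-x∣<∣p∣ z∈p-x-y)
  2≤∣p-x∣ = ≤-trans (s≤s 1≤∣p-x-y∣) (x∈p⇒∣p-x∣<∣p∣ y∈p-x)

Subsingleton : Subset n → Set
Subsingleton p = ∀ {a b} → a ∈ p → b ∈ p → a ≡ b

subsingleton⇒∣p∣≤1 : {p : Subset n} → Subsingleton p → ∣ p ∣ ≤ 1
subsingleton⇒∣p∣≤1 {n} {p} ss with nonempty? p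
... | yes (a , a∈p) = ≤-trans (p⊆q⇒∣p∣≤∣q∣ λ b∈p → subst (_∈ ⁅ a ⁆) (ss a∈p b∈p) (x∈⁅x⁆ a)) (≤-reflexive (∣⁅x⁆∣≡1 a))
... | no empty = ≤-trans (p⊆q⇒∣p∣≤∣q∣ {q = ∅} λ a∈p → ⊥-elim (empty (_ , a∈p))) (≤-trans (≤-reflexive (∣⊥∣≡0 n)) z≤n)

⊆⋃⇒∣p∣≤length : {p : Subset n} (𝒞 : List (Subset n)) → p ⊆ ⋃ 𝒞 → All (λ C → Subsingleton (p ∩ C)) 𝒞 → ∣ p ∣ ≤ length 𝒞
⊆⋃⇒∣p∣≤length {n} {p} [] p⊆∅ [] = ≤-trans (p⊆q⇒∣p∣≤∣q∣ p⊆∅) (≤-reflexive (∣⊥∣≡0 n))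
⊆⋃⇒∣p∣≤length {p = p} (C ∷ 𝒞) p⊆⋃ (p∩C-ss ∷ p∩𝒞-ss) = begin
  ∣ p ∣                 ≡⟨ ∣p∣≡∣p∩q∣+∣p─q∣ p C ⟩
  ∣ p ∩ C ∣ + ∣ p ─ C ∣ ≤⟨ +-mono-≤ (subsingleton⇒∣p∣≤1 p∩C-ss) (⊆⋃⇒∣p∣≤length 𝒞 p─C⊆⋃ (All.map shrink p∩𝒞-ss)) ⟩
  suc (length 𝒞)        ∎
  where
  open ≤-Reasoning
  p─C⊆⋃ : p ─ C ⊆ ⋃ 𝒞
  p─C⊆⋃ {x} x∈p─C with x∈p∪q⁻ C (⋃ 𝒞) (p⊆⋃ (p─q⊆p p C x∈p─C))
  ... | inj₁ x∈C = contradiction x∈C (x∈p─q⇒x∉q p C x∈p─C)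
  ... | inj₂ x∈⋃ = x∈⋃
  restrict : ∀ {x D} → x ∈ (p ─ C) ∩ D → x ∈ p ∩ D
  restrict {D = D} x∈ = let (x∈p─C , x∈D) = x∈p∩q⁻ (p ─ C) D x∈ in x∈p∩q⁺ (p─q⊆p p C x∈p─C , x∈D)
  shrink : ∀ {D} → Subsingleton (p ∩ D) → Subsingleton ((p ─ C) ∩ D)
  shrink ss a∈ b∈ = ss (restrict a∈) (restrict b∈)

Spread : List (Subset n) → Set
Spread 𝒞 = 𝒞 ≡ [] ⊎ 2 + length 𝒞 ≤ ∣ ⋃ 𝒞 ∣

spread-∷ : ∀ {x} {T : Subset n} (𝒞 : List (Subset n)) → 3 ≤ ∣ T ∣ → x ∈ T → x ∉ ⋃ 𝒞 → Spread 𝒞 → Spread (T ∷ 𝒞)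
spread-∷ {T = T} [] 3≤∣T∣ _ _ _ = inj₂ (≤-trans 3≤∣T∣ (∣p∣≤∣p∪q∣ T ∅))
spread-∷ {T = T} (C ∷ 𝒞) _ x∈T x∉⋃ (inj₂ spread) =
  inj₂ (≤-trans (s≤s spread) (p⊂q⇒∣p∣<∣q∣ (q⊆p∪q T (⋃ (C ∷ 𝒞)) , _ , x∈p∪q⁺ (inj₁ x∈T) , x∉⋃)))

-- multiplicity G 𝒞 v is definitionally length (through 𝒞 v).
through : List (Subset n) → Fin n → List (Subset n)
through 𝒞 v = filter (v ∈?_) 𝒞

Shares : List (Subset n) → Fin n → Fin n → Set
Shares 𝒞 u w = Any (λ C → u ∈ C × w ∈ C) 𝒞

∈⋃through⁻ : ∀ {u w : Fin n} 𝒞 → w ∈ ⋃ (through 𝒞 u) → Shares 𝒞 u w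
∈⋃through⁻ [] w∈∅ = contradiction w∈∅ ∉⊥
∈⋃through⁻ {u = u} {w} (C ∷ 𝒞) w∈ with u ∈? C
... | no _ = there (∈⋃through⁻ 𝒞 w∈)
... | yes u∈C with x∈p∪q⁻ C (⋃ (through 𝒞 u)) w∈
...   | inj₁ w∈C = here (u∈C , w∈C)
...   | inj₂ w∈⋃ = there (∈⋃through⁻ 𝒞 w∈⋃)

∈⋃through⁺ : ∀ {u w : Fin n} 𝒞 → Shares 𝒞 u w → w ∈ ⋃ (through 𝒞 u)
∈⋃through⁺ {u = u} (C ∷ 𝒞) shares with u ∈? C | shares
... | yes _ | here (_ , w∈C) = x∈p∪q⁺ (inj₁ w∈C)
... | yes _ | there shares′ = x∈p∪q⁺ (inj₂ (∈⋃through⁺ 𝒞 shares′))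
... | no u∉C | here (u∈C , _) = contradiction u∈C u∉C
... | no _ | there shares′ = ∈⋃through⁺ 𝒞 shares′

length-through-++ : ∀ (𝒞 𝒟 : List (Subset n)) v → length (through (𝒞 ++ 𝒟) v) ≡ length (through 𝒞 v) + length (through 𝒟 v)
length-through-++ 𝒞 𝒟 v = ≡.trans (cong length (filter-++ (v ∈?_) 𝒞 𝒟)) (length-++ (through 𝒞 v))

length-through-∷-suc : ∀ b (𝒞 : List (Subset n)) v → length (through (map (b ∷_) 𝒞) (suc v)) ≡ length (through 𝒞 v)
length-through-∷-suc b [] v = refl
length-through-∷-suc b (C ∷ 𝒞) v with does (v ∈? C)
... | true = cong suc (length-through-∷-suc b 𝒞 v)
... | false = length-through-∷-suc b 𝒞 v

length-through-inside∷-zero : (𝒞 : List (Subset n)) → length (through (map (inside ∷_) 𝒞) zero) ≡ length 𝒞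
length-through-inside∷-zero [] = refl
length-through-inside∷-zero (C ∷ 𝒞) = cong suc (length-through-inside∷-zero 𝒞)

length-through-outside∷-zero : (𝒞 : List (Subset n)) → length (through (map (outside ∷_) 𝒞) zero) ≡ 0
length-through-outside∷-zero [] = refl
length-through-outside∷-zero (C ∷ 𝒞) = length-through-outside∷-zero 𝒞

length-through-zero : (𝒜 ℬ : List (Subset n)) → length (through (map (inside ∷_) 𝒜 ++ map (outside ∷_) ℬ) zero) ≡ length 𝒜
length-through-zero 𝒜 ℬ = begin
  length (through (map (inside ∷_) 𝒜 ++ map (outside ∷_) ℬ) zero)                ≡⟨ length-through-++ (map (inside ∷_) 𝒜) _ zero ⟩
  length (through (map (inside ∷_) 𝒜) zero) + length (through (map (outside ∷_) ℬ) zero) ≡⟨ cong₂ _+_ (length-through-inside∷-zero 𝒜) (length-through-outside∷-zero ℬ) ⟩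
  length 𝒜 + 0                                                                 ≡⟨ +-identityʳ (length 𝒜) ⟩
  length 𝒜                                                                     ∎
  where open ≡.≡-Reasoning

length-through-suc : ∀ b b′ (𝒜 ℬ : List (Subset n)) v →
  length (through (map (b ∷_) 𝒜 ++ map (b′ ∷_) ℬ) (suc v)) ≡ length (through 𝒜 v) + length (through ℬ v)
length-through-suc b b′ 𝒜 ℬ v =
  ≡.trans (length-through-++ (map (b ∷_) 𝒜) _ (suc v)) (cong₂ _+_ (length-through-∷-suc b 𝒜 v) (length-through-∷-suc b′ ℬ v))

module _ (G : Graph n) where

  adj⇒≢ : ∀ {u w} → adj G u w ≡ true → u ≢ w
  adj⇒≢ {u} uw refl with ≡.trans (≡.sym (irrefl G u)) uw
  ... | ()

  adj-sym : ∀ {u w} → adj G u w ≡ true → adj G w u ≡ true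
  adj-sym {u} {w} uw = ≡.trans (sym G w u) uw

  adj⇒∈N : ∀ {v w} → adj G v w ≡ true → w ∈ N G v
  adj⇒∈N {v} {w} vw = lookup⇒[]= w (N G v) (≡.trans (lookup∘tabulate _ w) (cong (if_then inside else outside) vw))

  ∈N⇒adj : ∀ {v w} → w ∈ N G v → adj G v w ≡ true
  ∈N⇒adj {v} {w} w∈N with adj G v w | ≡.trans (≡.sym (lookup∘tabulate _ w)) ([]=⇒lookup w∈N)
  ... | true | _ = refl
  ... | false | ()

  lookup-N-comm : ∀ u w → lookup (N G u) w ≡ lookup (N G w) u
  lookup-N-comm u w = ≡.trans (lookup∘tabulate _ w)
    (≡.trans (cong (if_then inside else outside) (sym G u w)) (≡.sym (lookup∘tabulate _ u)))

  Covers : List (Subset n) → Set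
  Covers 𝒞 = ∀ u w → adj G u w ≡ true → Shares 𝒞 u w

  shares⇒adj : ∀ {u w} {𝒞 : List (Subset n)} → All (IsClique G) 𝒞 → Shares 𝒞 u w → u ≢ w → adj G u w ≡ true
  shares⇒adj cliques shares u≢w =
    let (clique , u∈C , w∈C) = All.lookupAny cliques shares in clique _ _ u∈C w∈C u≢w

deleteZero : Graph (suc n) → Graph n
deleteZero H = record
  { adj = λ u w → adj H (suc u) (suc w)
  ; sym = λ u w → sym H (suc u) (suc w)
  ; irrefl = irrefl H ∘ suc
  }

singletons : Subset n → List (Subset n)
singletons [] = []
singletons (outside ∷ p) = map (outside ∷_) (singletons p)
singletons (inside ∷ p) = (inside ∷ ∅) ∷ map (outside ∷_) (singletons p)

singletons-⁅⁆ : (p : Subset n) → All (λ C → ∃ λ w → w ∈ p × C ≡ ⁅ w ⁆) (singletons p)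
singletons-⁅⁆ [] = []
singletons-⁅⁆ (outside ∷ p) = AllP.map⁺ (All.map (λ { (w , w∈p , refl) → suc w , there w∈p , refl }) (singletons-⁅⁆ p))
singletons-⁅⁆ (inside ∷ p) =
  (zero , here , refl) ∷ AllP.map⁺ (All.map (λ { (w , w∈p , refl) → suc w , there w∈p , refl }) (singletons-⁅⁆ p))

∈singletons : ∀ {w} (p : Subset n) → w ∈ p → Any (w ∈_) (singletons p)
∈singletons (inside ∷ p) here = here here
∈singletons (inside ∷ p) (there w∈p) = there (AnyP.map⁺ (Any.map there (∈singletons p w∈p)))
∈singletons (outside ∷ p) (there w∈p) = AnyP.map⁺ (Any.map there (∈singletons p w∈p))

length-singletons : (p : Subset n) → length (singletons p) ≡ ∣ p ∣
length-singletons [] = refl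
length-singletons (outside ∷ p) = ≡.trans (length-map _ (singletons p)) (length-singletons p)
length-singletons (inside ∷ p) = cong suc (≡.trans (length-map _ (singletons p)) (length-singletons p))

length-through-singletons : ∀ (p : Subset n) v → length (through (singletons p) v) ≡ ∣ lookup p v ∷ [] ∣
length-through-singletons (outside ∷ p) zero = length-through-outside∷-zero (singletons p)
length-through-singletons (inside ∷ p) zero = cong suc (length-through-outside∷-zero (singletons p))
length-through-singletons (outside ∷ p) (suc v) =
  ≡.trans (length-through-∷-suc outside (singletons p) v) (length-through-singletons p v)
length-through-singletons (inside ∷ p) (suc v) with v ∈? ∅
... | yes v∈∅ = contradiction v∈∅ ∉⊥
... | no _ = ≡.trans (length-through-∷-suc outside (singletons p) v) (length-through-singletons p v)

∣x∷p∣≡∣x∷[]∣+∣p∣ : ∀ x (p : Subset n) → ∣ x ∷ p ∣ ≡ ∣ x ∷ [] ∣ + ∣ p ∣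
∣x∷p∣≡∣x∷[]∣+∣p∣ inside p = refl
∣x∷p∣≡∣x∷[]∣+∣p∣ outside p = refl

-- inside ∷ ⁅ w ⁆ is the edge {0, suc w}: one for each neighbour of 0, then the edges among the others.
edgeCliques : Graph n → List (Subset n)
edgeCliques {zero} H = []
edgeCliques {suc n} H =
  map (inside ∷_) (singletons (tail (N H zero))) ++ map (outside ∷_) (edgeCliques (deleteZero H))

inside∷⁅⁆-isClique : (H : Graph (suc n)) {w : Fin n} → adj H zero (suc w) ≡ true → IsClique H (inside ∷ ⁅ w ⁆)
inside∷⁅⁆-isClique H 0w zero zero _ _ 0≢0 = contradiction refl 0≢0
inside∷⁅⁆-isClique H {w} 0w zero (suc b) _ (there b∈⁅w⁆) _ rewrite x∈⁅y⁆⇒x≡y w b∈⁅w⁆ = 0w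
inside∷⁅⁆-isClique H {w} 0w (suc a) zero (there a∈⁅w⁆) _ _ rewrite x∈⁅y⁆⇒x≡y w a∈⁅w⁆ = adj-sym H 0w
inside∷⁅⁆-isClique H {w} 0w (suc a) (suc b) (there a∈⁅w⁆) (there b∈⁅w⁆) a≢b =
  contradiction (cong suc (≡.trans (x∈⁅y⁆⇒x≡y w a∈⁅w⁆) (≡.sym (x∈⁅y⁆⇒x≡y w b∈⁅w⁆)))) a≢b

outside∷-isClique : (H : Graph (suc n)) {C : Subset n} → IsClique (deleteZero H) C → IsClique H (outside ∷ C)
outside∷-isClique H clique (suc a) (suc b) (there a∈C) (there b∈C) a≢b = clique a b a∈C b∈C (a≢b ∘ cong suc)

edgeCliques-isClique : (H : Graph n) → All (IsClique H) (edgeCliques H)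
edgeCliques-isClique {zero} H = []
edgeCliques-isClique {suc n} H =
  AllP.++⁺ (AllP.map⁺ (All.map star (singletons-⁅⁆ _)))
           (AllP.map⁺ (All.map (outside∷-isClique H) (edgeCliques-isClique (deleteZero H))))
  where
  star : ∀ {C} → (∃ λ w → w ∈ tail (N H zero) × C ≡ ⁅ w ⁆) → IsClique H (inside ∷ C)
  star (w , w∈N , refl) = inside∷⁅⁆-isClique H (∈N⇒adj H (there w∈N))

edge₀-covered : (H : Graph (suc n)) {w : Fin n} → adj H zero (suc w) ≡ true →
  Shares (map (inside ∷_) (singletons (tail (N H zero)))) zero (suc w)
edge₀-covered H 0w = AnyP.map⁺ (Any.map (λ w∈C → here , there w∈C) (∈singletons _ (drop-there (adj⇒∈N H 0w))))

edgeCliques-covers : (H : Graph n) → Covers H (edgeCliques H)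
edgeCliques-covers {suc n} H zero zero 0-0 = contradiction refl (adj⇒≢ H 0-0)
edgeCliques-covers {suc n} H zero (suc w) 0w = AnyP.++⁺ˡ (edge₀-covered H 0w)
edgeCliques-covers {suc n} H (suc u) zero u0 = AnyP.++⁺ˡ (Any.map swap (edge₀-covered H (adj-sym H u0)))
edgeCliques-covers {suc n} H (suc u) (suc w) uw =
  AnyP.++⁺ʳ _ (AnyP.map⁺ (Any.map (λ (u∈C , w∈C) → there u∈C , there w∈C) (edgeCliques-covers (deleteZero H) u w uw)))

edgeCliques-multiplicity : ∀ (H : Graph n) v → multiplicity H (edgeCliques H) v ≤ deg H v
edgeCliques-multiplicity {suc n} H zero = begin
  length (through (edgeCliques H) zero)     ≡⟨ length-through-zero (singletons (tail (N H zero))) (edgeCliques (deleteZero H)) ⟩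
  length (singletons (tail (N H zero)))     ≡⟨ length-singletons (tail (N H zero)) ⟩
  ∣ tail (N H zero) ∣                        ≤⟨ ∣p∣≤∣x∷p∣ (lookup (N H zero) zero) (tail (N H zero)) ⟩
  deg H zero                                ∎
  where open ≤-Reasoning
edgeCliques-multiplicity {suc n} H (suc v) = begin
  length (through (edgeCliques H) (suc v))
    ≡⟨ length-through-suc inside outside (singletons (tail (N H zero))) (edgeCliques (deleteZero H)) v ⟩
  length (through (singletons (tail (N H zero))) v) + multiplicity H′ (edgeCliques H′) v
    ≤⟨ +-mono-≤ (≤-reflexive (length-through-singletons (tail (N H zero)) v)) (edgeCliques-multiplicity H′ v) ⟩
  ∣ lookup (N H zero) (suc v) ∷ [] ∣ + deg H′ v
    ≡⟨ cong (λ b → ∣ b ∷ [] ∣ + deg H′ v) (lookup-N-comm H zero (suc v)) ⟩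
  ∣ lookup (N H (suc v)) zero ∷ [] ∣ + deg H′ v
    ≡⟨ ≡.sym (∣x∷p∣≡∣x∷[]∣+∣p∣ (lookup (N H (suc v)) zero) (N H′ v)) ⟩
  deg H (suc v)
    ∎
  where
  open ≤-Reasoning
  H′ = deleteZero H

module _ (G : Graph n) where

  TriangleAt : Fin n → Set
  TriangleAt x = ∃₂ λ y z → adj G x y ≡ true × adj G x z ≡ true × adj G y z ≡ true

  independent⊎triangle : ∀ x → Independent G (N G x) ⊎ TriangleAt x
  independent⊎triangle x with any? (λ y → any? λ z → (y ∈? N G x) ×-dec (z ∈? N G x) ×-dec (adj G y z Bool.≟ true))
  ... | yes (y , z , y∈N , z∈N , yz) = inj₂ (y , z , ∈N⇒adj G y∈N , ∈N⇒adj G z∈N , yz)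
  ... | no noTriangle = inj₁ λ u w u∈N w∈N → ¬-not λ uw → noTriangle (u , w , u∈N , w∈N , uw)

  triangle⊎independent : ∀ Δ x → (deg G x ≡ Δ → TriangleAt x) ⊎ (deg G x ≡ Δ × Independent G (N G x))
  triangle⊎independent Δ x with deg G x ≟ Δ | independent⊎triangle x
  ... | no degx≢Δ | _ = inj₁ λ degx≡Δ → contradiction degx≡Δ degx≢Δ
  ... | yes degx≡Δ | inj₁ independent = inj₂ (degx≡Δ , independent)
  ... | yes _ | inj₂ triangle = inj₁ λ _ → triangle

  triangle : ∀ {x} → TriangleAt x → Subset n
  triangle {x} (y , z , _) = ⁅ x ⁆ ∪ ⁅ y ⁆ ∪ ⁅ z ⁆

  x∈triangle : ∀ {x} (t : TriangleAt x) → x ∈ triangle t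
  x∈triangle {x} _ = x∈p∪q⁺ (inj₁ (x∈⁅x⁆ x))

  3≤∣triangle∣ : ∀ {x} (t : TriangleAt x) → 3 ≤ ∣ triangle t ∣
  3≤∣triangle∣ t@(y , z , xy , xz , yz) =
    distinct³⇒3≤∣p∣ (x∈triangle t) (x∈p∪q⁺ (inj₂ (x∈p∪q⁺ (inj₁ (x∈⁅x⁆ y))))) (x∈p∪q⁺ (inj₂ (x∈p∪q⁺ (inj₂ (x∈⁅x⁆ z)))))
      (adj⇒≢ G xy) (adj⇒≢ G xz) (adj⇒≢ G yz)

  triangle-isClique : ∀ {x} (t : TriangleAt x) → IsClique G (triangle t)
  triangle-isClique {x} t@(y , z , xy , xz , yz) a b a∈ b∈ a≢b with corner a∈ | corner b∈
    where
    corner : ∀ {a} → a ∈ triangle t → a ≡ x ⊎ a ≡ y ⊎ a ≡ z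
    corner {a} a∈ with x∈p∪q⁻ ⁅ x ⁆ (⁅ y ⁆ ∪ ⁅ z ⁆) a∈
    ... | inj₁ a∈x = inj₁ (x∈⁅y⁆⇒x≡y x a∈x)
    ... | inj₂ a∈yz with x∈p∪q⁻ ⁅ y ⁆ ⁅ z ⁆ a∈yz
    ...   | inj₁ a∈y = inj₂ (inj₁ (x∈⁅y⁆⇒x≡y y a∈y))
    ...   | inj₂ a∈z = inj₂ (inj₂ (x∈⁅y⁆⇒x≡y z a∈z))
  ... | inj₁ refl | inj₁ refl = contradiction refl a≢b
  ... | inj₁ refl | inj₂ (inj₁ refl) = xy
  ... | inj₁ refl | inj₂ (inj₂ refl) = xz
  ... | inj₂ (inj₁ refl) | inj₁ refl = adj-sym G xy
  ... | inj₂ (inj₁ refl) | inj₂ (inj₁ refl) = contradiction refl a≢b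
  ... | inj₂ (inj₁ refl) | inj₂ (inj₂ refl) = yz
  ... | inj₂ (inj₂ refl) | inj₁ refl = adj-sym G xz
  ... | inj₂ (inj₂ refl) | inj₂ (inj₁ refl) = adj-sym G yz
  ... | inj₂ (inj₂ refl) | inj₂ (inj₂ refl) = contradiction refl a≢b

  -- A triangle is only added at a vertex x lying in no earlier triangle, so for every other
  -- vertex of the new triangle, x enlarges the union of its triangles: Spread is preserved.
  triangleFamily : (xs : List (Fin n)) → All TriangleAt xs →
    ∃ λ 𝒯 → All (IsClique G) 𝒯 × (∀ v → Spread (through 𝒯 v)) × All (λ x → Any (x ∈_) 𝒯) xs
  triangleFamily [] [] = [] , [] , (λ _ → inj₁ refl) , []
  triangleFamily (x ∷ xs) (t ∷ ts) with triangleFamily xs ts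
  ... | 𝒯 , cliques , spread , covered with Any.any? (x ∈?_) 𝒯
  ...   | yes x∈𝒯 = 𝒯 , cliques , spread , x∈𝒯 ∷ covered
  ...   | no x∉𝒯 = triangle t ∷ 𝒯 , triangle-isClique t ∷ cliques , spread′ , here (x∈triangle t) ∷ All.map there covered
    where
    spread′ : ∀ v → Spread (through (triangle t ∷ 𝒯) v)
    spread′ v with v ∈? triangle t
    ... | yes _ = spread-∷ (through 𝒯 v) (3≤∣triangle∣ t) (x∈triangle t) (x∉𝒯 ∘ Any.map proj₂ ∘ ∈⋃through⁻ 𝒯) (spread v)
    ... | no _ = spread v

  shares? : (𝒞 : List (Subset n)) (u w : Fin n) → Dec (Shares 𝒞 u w)
  shares? 𝒞 u w = Any.any? (λ C → (u ∈? C) ×-dec (w ∈? C)) 𝒞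

  residual : List (Subset n) → Graph n
  residual 𝒞 = record
    { adj = λ u w → adj G u w ∧ not (does (shares? 𝒞 u w))
    ; sym = λ u w → cong₂ _∧_ (sym G u w)
        (cong not (does-⇔ (mk⇔ (Any.map swap) (Any.map swap)) (shares? 𝒞 u w) (shares? 𝒞 w u)))
    ; irrefl = λ u → cong (_∧ _) (irrefl G u)
    }

  residual-adj : (𝒞 : List (Subset n)) (u w : Fin n) → adj (residual 𝒞) u w ≡ true → adj G u w ≡ true × ¬ Shares 𝒞 u w
  residual-adj 𝒞 u w uw with adj G u w | shares? 𝒞 u w | uw
  ... | true | no ¬shares | _ = refl , ¬shares
  ... | true | yes _ | ()
  ... | false | _ | ()

  adj⇒residual : (𝒞 : List (Subset n)) (u w : Fin n) → adj G u w ≡ true → ¬ Shares 𝒞 u w → adj (residual 𝒞) u w ≡ true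
  adj⇒residual 𝒞 u w uw ¬shares rewrite uw | dec-false (shares? 𝒞 u w) ¬shares = refl

  N-residual⊆ : (𝒞 : List (Subset n)) (v : Fin n) → N (residual 𝒞) v ⊆ N G v ─ ⋃ (through 𝒞 v)
  N-residual⊆ 𝒞 v w∈N =
    let (vw , ¬shares) = residual-adj 𝒞 v _ (∈N⇒adj (residual 𝒞) w∈N)
    in x∈p∧x∉q⇒x∈p─q (adj⇒∈N G vw) (¬shares ∘ ∈⋃through⁻ 𝒞)

  ∣⋃through∣≤1+∣N∩⋃through∣ : ∀ {𝒞} → All (IsClique G) 𝒞 → ∀ v → ∣ ⋃ (through 𝒞 v) ∣ ≤ suc ∣ N G v ∩ ⋃ (through 𝒞 v) ∣
  ∣⋃through∣≤1+∣N∩⋃through∣ {𝒞} cliques v = p-x⊆q⇒∣p∣≤1+∣q∣ λ {w} w∈K-v →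
    let w∈K = p─q⊆p _ ⁅ v ⁆ w∈K-v
        w≢v = x∉⁅y⁆⇒x≢y (x∈p─q⇒x∉q _ ⁅ v ⁆ w∈K-v)
    in x∈p∩q⁺ (adj⇒∈N G (shares⇒adj G cliques (∈⋃through⁻ 𝒞 w∈K) (w≢v ∘ ≡.sym)) , w∈K)

  -- The residual edges at v avoid the neighbours of v inside its cliques, and Spread says
  -- these neighbours outnumber the cliques.
  spread⇒through+residual<deg : ∀ {𝒞} → All (IsClique G) 𝒞 → ∀ v → 2 + length (through 𝒞 v) ≤ ∣ ⋃ (through 𝒞 v) ∣ →
    suc (length (through 𝒞 v) + deg (residual 𝒞) v) ≤ deg G v
  spread⇒through+residual<deg {𝒞} cliques v spread = begin
    suc (length (through 𝒞 v)) + deg (residual 𝒞) v ≤⟨ +-mono-≤ 1+ℓ≤ (p⊆q⇒∣p∣≤∣q∣ (N-residual⊆ 𝒞 v)) ⟩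
    ∣ N G v ∩ K ∣ + ∣ N G v ─ K ∣                   ≡⟨ ≡.sym (∣p∣≡∣p∩q∣+∣p─q∣ (N G v) K) ⟩
    deg G v                                         ∎
    where
    open ≤-Reasoning
    K = ⋃ (through 𝒞 v)
    1+ℓ≤ : suc (length (through 𝒞 v)) ≤ ∣ N G v ∩ K ∣
    1+ℓ≤ = ≤-pred (≤-trans spread (∣⋃through∣≤1+∣N∩⋃through∣ cliques v))

  spreadFamily⇒covering : ∀ Δ → (∀ x → deg G x ≤ Δ) → (𝒯 : List (Subset n)) → All (IsClique G) 𝒯 →
    (∀ v → Spread (through 𝒯 v)) → (∀ x → deg G x ≡ Δ → Any (x ∈_) 𝒯) → HasKCliqueCovering G (pred Δ)
  spreadFamily⇒covering Δ bounded 𝒯 cliques spread covered =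
    𝒯 ++ ℰ , AllP.++⁺ cliques (All.map residual-isClique (edgeCliques-isClique R)) , covers , multiplicity≤
    where
    R = residual 𝒯
    ℰ = edgeCliques R
    residual-isClique : ∀ {C} → IsClique R C → IsClique G C
    residual-isClique clique a b a∈C b∈C a≢b = proj₁ (residual-adj 𝒯 a b (clique a b a∈C b∈C a≢b))
    covers : Covers G (𝒯 ++ ℰ)
    covers u w uw with shares? 𝒯 u w
    ... | yes shares = AnyP.++⁺ˡ shares
    ... | no ¬shares = AnyP.++⁺ʳ 𝒯 (edgeCliques-covers R u w (adj⇒residual 𝒯 u w uw ¬shares))
    uncovered<Δ : ∀ {v} → through 𝒯 v ≡ [] → deg G v < Δ
    uncovered<Δ {v} none = ≤∧≢⇒< (bounded v) λ degv≡Δ →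
      ∉⊥ (subst (λ 𝒞 → v ∈ ⋃ 𝒞) none (∈⋃through⁺ 𝒯 (Any.map (λ v∈C → v∈C , v∈C) (covered v degv≡Δ))))
    local : ∀ v → Spread (through 𝒯 v) → suc (length (through 𝒯 v) + deg R v) ≤ Δ
    local v (inj₁ none) = subst (λ 𝒞 → suc (length 𝒞 + deg R v) ≤ Δ) (≡.sym none)
      (≤-trans (s≤s (p⊆q⇒∣p∣≤∣q∣ (p─q⊆p _ _ ∘ N-residual⊆ 𝒯 v))) (uncovered<Δ none))
    local v (inj₂ spread) = ≤-trans (spread⇒through+residual<deg cliques v spread) (bounded v)
    multiplicity≤ : ∀ v → multiplicity G (𝒯 ++ ℰ) v ≤ pred Δ
    multiplicity≤ v = <⇒≤pred (begin
      suc (length (through (𝒯 ++ ℰ) v))                 ≡⟨ cong suc (length-through-++ 𝒯 ℰ v) ⟩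
      suc (length (through 𝒯 v) + length (through ℰ v)) ≤⟨ s≤s (+-monoʳ-≤ (length (through 𝒯 v)) (edgeCliques-multiplicity R v)) ⟩
      suc (length (through 𝒯 v) + deg R v)              ≤⟨ local v (spread v) ⟩
      Δ                                                 ∎)
      where open ≤-Reasoning

  triangles⇒covering : ∀ Δ → (∀ x → deg G x ≤ Δ) → (∀ x → deg G x ≡ Δ → TriangleAt x) → HasKCliqueCovering G (pred Δ)
  triangles⇒covering Δ bounded triangleAt
    with triangleFamily (filter (λ x → deg G x ≟ Δ) (allFin n)) (All.map (triangleAt _) (AllP.all-filter _ (allFin n)))
  ... | 𝒯 , cliques , spread , covered =
    spreadFamily⇒covering Δ bounded 𝒯 cliques spread λ x degx≡Δ → All.lookup covered (∈-filter⁺ _ (∈-allFin x) degx≡Δ)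

  bounded⇒covering : ∀ Δ → (∀ x → deg G x ≤ Δ) → HasKCliqueCovering G Δ
  bounded⇒covering Δ bounded =
    edgeCliques G , edgeCliques-isClique G , edgeCliques-covers G , λ v → ≤-trans (edgeCliques-multiplicity G v) (bounded v)

  -- A clique through x contains at most one vertex of the independent set N(x).
  independent⇒deg≤multiplicity : ∀ {𝒞 x} → All (IsClique G) 𝒞 → Covers G 𝒞 → Independent G (N G x) →
    deg G x ≤ multiplicity G 𝒞 x
  independent⇒deg≤multiplicity {𝒞} {x} cliques covers independent =
    ⊆⋃⇒∣p∣≤length (through 𝒞 x) (λ {w} w∈N → ∈⋃through⁺ 𝒞 (covers x w (∈N⇒adj G w∈N)))
      (All.map meetsOnce (AllP.filter⁺ (x ∈?_) cliques))
    where
    meetsOnce : ∀ {C} → IsClique G C → Subsingleton (N G x ∩ C)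
    meetsOnce {C} clique {a} {b} a∈ b∈ with a Fin.≟ b
    ... | yes a≡b = a≡b
    ... | no a≢b =
      let (a∈N , a∈C) = x∈p∩q⁻ (N G x) C a∈
          (b∈N , b∈C) = x∈p∩q⁻ (N G x) C b∈
      in contradiction (≡.trans (≡.sym (clique a b a∈C b∈C a≢b)) (independent a b a∈N b∈N)) λ ()

IndependentNeighbourhood : Graph n → ℕ → Set
IndependentNeighbourhood {n} G Δ = ∃ λ (x : Fin n) → deg G x ≡ Δ × Independent G (N G x)

⊆∧∣∣≥⇒⊇ : {p q : Subset n} → p ⊆ q → ∣ q ∣ ≤ ∣ p ∣ → q ⊆ p
⊆∧∣∣≥⇒⊇ {p = p} {q} p⊆q ∣q∣≤∣p∣ {x} x∈q with x ∈? p
... | yes x∈p = x∈p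
... | no x∉p = contradiction (p⊂q⇒∣p∣<∣q∣ (p⊆q , x , x∈q , x∉p)) (≤⇒≯ ∣q∣≤∣p∣)

independent⇒lcc : (G : Graph n) (Δ : ℕ) → (∀ x → deg G x ≤ Δ) → IndependentNeighbourhood G Δ → LccIs G Δ
independent⇒lcc G Δ bounded (x , degx≡Δ , independent) =
  bounded⇒covering G Δ bounded , λ k (𝒞 , cliques , covers , k-bounded) →
    ≤-trans (≤-reflexive (≡.sym degx≡Δ)) (≤-trans (independent⇒deg≤multiplicity G cliques covers independent) (k-bounded x))

lcc⇒independent : (G : Graph n) (Δ : ℕ) → MaxDegree G Δ → LccIs G Δ → IndependentNeighbourhood G Δ
lcc⇒independent {n} G Δ ((x₀ , degx₀≡Δ) , bounded) (_ , minimal)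
  with All.decide (triangle⊎independent G Δ) (allFin n)
... | inj₂ independentAt = Any.satisfied independentAt
... | inj₁ triangleAt = contradiction (minimal (pred Δ) (triangles⇒covering G Δ bounded triangleAt′)) (0<m⇒m≰pred[m] 0<Δ)
  where
  triangleAt′ : ∀ x → deg G x ≡ Δ → TriangleAt G x
  triangleAt′ x = All.lookup triangleAt (∈-allFin x)
  0<Δ : 0 < Δ
  0<Δ with triangleAt′ x₀ degx₀≡Δ
  ... | (_ , _ , x₀y , _) = subst (0 <_) degx₀≡Δ (≤-trans (s≤s z≤n) (x∈p⇒∣p-x∣<∣p∣ (adj⇒∈N G x₀y)))
  0<m⇒m≰pred[m] : ∀ {m} → 0 < m → ¬ m ≤ pred m
  0<m⇒m≰pred[m] (s≤s _) = <-irrefl refl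

independent⇔αₗ : (G : Graph n) (Δ : ℕ) → (∀ x → deg G x ≤ Δ) → IndependentNeighbourhood G Δ ⇔ AlphaLIs G Δ
independent⇔αₗ G Δ bounded = mk⇔
  (λ (x , degx≡Δ , independent) →
     (x , N G x , (λ w∈N → w∈N) , independent , degx≡Δ) ,
     λ t (y , S , S⊆N , _ , ∣S∣≡t) → subst (_≤ Δ) ∣S∣≡t (≤-trans (p⊆q⇒∣p∣≤∣q∣ S⊆N) (bounded y)))
  (λ ((x , S , S⊆N , independentS , ∣S∣≡Δ) , _) →
     let ∣N∣≤∣S∣ = ≤-trans (bounded x) (≤-reflexive (≡.sym ∣S∣≡Δ))
         N⊆S = ⊆∧∣∣≥⇒⊇ S⊆N ∣N∣≤∣S∣
     in x , ≤-antisym (bounded x) (≤-trans (≤-reflexive (≡.sym ∣S∣≡Δ)) (p⊆q⇒∣p∣≤∣q∣ S⊆N)) ,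
        λ u w u∈N w∈N → independentS u w (N⊆S u∈N) (N⊆S w∈N))

proposition3 : ∀ {n} (G : Graph n) (Δ : ℕ) → MaxDegree G Δ →
    (LccIs G Δ ⇔ (∃ λ (x : Fin n) → deg G x ≡ Δ × Independent G (N G x)))
    × ((∃ λ (x : Fin n) → deg G x ≡ Δ × Independent G (N G x)) ⇔ AlphaLIs G Δ)
proposition3 G Δ maxDegree@(_ , bounded) =
  mk⇔ (lcc⇒independent G Δ maxDegree) (independent⇒lcc G Δ bounded) , independent⇔αₗ G Δ bounded
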